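{- Let $|A|=n$. (i) The cardinality of $\mathrm{Styl}(A)$ is the Bell number $B_{n+1}$ (the number of partitions of a set with $n+1$ elements). (ii) $\mathrm{Styl}(A)$ is presented by generators $A$ subject to the plactic relations $bac=bca$, $acb=cab$ for all letters $a<b<c$, $baa=aba$, $bba=bab$ for all letters $a<b$, together with the relations $x^2=x$ for all $x\in A$.
   Context: $A$ is a finite totally ordered alphabet and $A^*$ the free monoid on $A$. A column is a subset of $A$, identified with the strictly decreasing word of its elements. For a column $\gamma$ and a letter $x$: if $x>y$ for all $y\in\gamma$, let $x\cdot\gamma=\gamma\cup\{x\}$; otherwise let $y$ be the smallest element of $\gamma$ with $y\geq x$ and let $x\cdot\gamma=(\gamma\setminus\{y\})\cup\{x\}$. This extends to a left action of $A^*$ on the set of columns by $(uv)\cdot\gamma=u\cdot(v\cdot\gamma)$. $\mathrm{Styl}(A)$ (the stylic monoid) is the monoid of maps of the set of columns to itself induced by the words under this action; equivalently it is $A^*$ modulo the congruence $u\equiv_{styl}v$ iff $u\cdot\gamma=v\cdot\gamma$ for all columns $\gamma$. -}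

module Defs where

open import Data.Nat as ℕ using (ℕ; zero; suc; _+_; _*_)
open import Data.Fin as Fin using (Fin)
open import Data.Fin.Properties using (_≤?_)
open import Data.Fin.Subset using (Subset; inside; outside)
open import Data.Fin.Subset.Properties using (_∈?_)
open import Data.List using (List; []; _∷_; _++_; [_]; foldr; allFin; head)
open import Data.Vec using (Vec; _[_]≔_; lookup)
open import Data.Maybe using (Maybe; just; nothing)
open import Data.Bool using (true; false)
open import Relation.Nullary using (yes; no)
open import Relation.Binary.PropositionalEquality using (_≡_)

Letter : ℕ → Set
Letter n = Fin n

Word : ℕ → Set
Word n = List (Letter n)

Column : ℕ → Set
Column n = Subset n

firstGeq : ∀ {n} → Letter n → Column n → List (Letter n) → Maybe (Letter n)
firstGeq x γ [] = nothing
firstGeq x γ (y ∷ ys) with x ≤? y | y ∈? γ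
... | yes _ | yes _ = just y
... | _     | _     = firstGeq x γ ys

-- smallest element y of γ with y ≥ x (allFin n lists Fin n in increasing order)
smallestGeq : ∀ {n} → Letter n → Column n → Maybe (Letter n)
smallestGeq {n} x γ = firstGeq x γ (allFin n)

_·_ : ∀ {n} → Letter n → Column n → Column n
x · γ with smallestGeq x γ
... | nothing = γ [ x ]≔ inside
... | just y  = (γ [ y ]≔ outside) [ x ]≔ inside

act : ∀ {n} → Word n → Column n → Column n
act w γ = foldr _·_ γ w

_≡styl_ : ∀ {n} → Word n → Word n → Set
u ≡styl v = ∀ γ → act u γ ≡ act v γ

stirling2 : ℕ → ℕ → ℕ
stirling2 zero    zero    = 1
stirling2 zero    (suc k) = 0
stirling2 (suc m) zero    = 0
stirling2 (suc m) (suc k) = suc k * stirling2 m (suc k) + stirling2 m k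

sumTo : (ℕ → ℕ) → ℕ → ℕ
sumTo f zero    = f zero
sumTo f (suc k) = sumTo f k + f (suc k)

bell : ℕ → ℕ
bell m = sumTo (stirling2 m) m

data Rel {n : ℕ} : Word n → Word n → Set where
  pl₁  : ∀ {a b c : Letter n} → a Fin.< b → b Fin.< c → Rel (b ∷ a ∷ c ∷ []) (b ∷ c ∷ a ∷ [])
  pl₂  : ∀ {a b c : Letter n} → a Fin.< b → b Fin.< c → Rel (a ∷ c ∷ b ∷ []) (c ∷ a ∷ b ∷ [])
  pl₃  : ∀ {a b : Letter n} → a Fin.< b → Rel (b ∷ a ∷ a ∷ []) (a ∷ b ∷ a ∷ [])
  pl₄  : ∀ {a b : Letter n} → a Fin.< b → Rel (b ∷ b ∷ a ∷ []) (b ∷ a ∷ b ∷ [])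
  idem : ∀ {x : Letter n} → Rel (x ∷ x ∷ []) (x ∷ [])

data _~_ {n : ℕ} : Word n → Word n → Set where
  step  : ∀ {l r} (u v : Word n) → Rel l r → (u ++ l ++ v) ~ (u ++ r ++ v)
  ~refl : ∀ {w} → w ~ w
  ~sym  : ∀ {u v} → u ~ v → v ~ u
  ~trans : ∀ {u v w} → u ~ v → v ~ w → u ~ w

-- The action of a letter on a column is computed by recursion on the alphabet (`insert`):
-- the least letter 0 takes the place of the minimum of the column, and any other letter
-- leaves 0 alone and acts on the rest. By induction the plactic and idempotency relations
-- then hold in Styl(A), so u ~ v implies u ≡styl v.
--
-- Conversely, normal forms over 0 < 1 < … < n are obtained by adjoining a new least letter 0
-- to a normal form E over 1 < … < n: they are E itself and the words D 0 E, with D an initial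
-- segment of the column E·∅ read decreasingly. Inserting the letters of a word one at a time
-- and rewriting with the relations shows that every word is congruent to a normal form.
-- Distinct normal forms act differently: within one fibre they have different columns, and
-- across fibres they act on columns containing 0 as their parents E do. Finally, if E·∅ has
-- k elements, E gives rise to k + 1 normal forms whose column has k elements and one whose
-- column has k + 1, which is the recurrence S(m + 1, k + 1) = (k + 1) S(m, k + 1) + S(m, k)
-- of the Stirling numbers; hence there are B(n + 1) normal forms.

module Submission where

open import Defs
open import Data.Nat as ℕ using (ℕ; zero; suc; z≤n; s≤s; _+_; _*_)
import Data.Nat.Properties as ℕₚ
open import Data.Nat.ListAction using (sum)
open import Data.Nat.ListAction.Properties using (sum-++)
open import Data.Nat.Tactic.RingSolver using (solve-∀)
open import Data.Fin as Fin using (Fin; zero; suc)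
open import Data.Fin.Subset using (inside; outside; _∈_; _∉_; ∣_∣) renaming (⊥ to ∅)
open import Data.Fin.Subset.Properties using (_∈?_; ∉⊥; drop-there)
open import Data.Fin.Properties as Finₚ using (_≤?_)
open import Data.List as List using (List; []; _∷_; _++_; _∷ʳ_; foldr; allFin; tabulate)
open import Data.List.Properties using (map-tabulate; foldr-++; ++-assoc; map-++; map-∘; map-cong)
import Data.Vec.Properties as Vecₚ
open import Data.Vec as Vec using (Vec; []; _∷_; _[_]≔_; lookup; here; there)
open import Data.Maybe as Maybe using (Maybe; just; nothing)
open import Data.Bool using (true; false)
open import Data.Empty using (⊥-elim)
open import Data.Product using (Σ; ∃; _×_; _,_)
open import Data.Sum using (inj₁; inj₂)
open import Data.Unit using (⊤; tt)
open import Data.List.Relation.Unary.All as All using (All; []; _∷_)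
open import Data.List.Relation.Unary.All.Properties as Allₚ using (gmap⁺; gmap⁻)
open import Data.List.Relation.Unary.AllPairs as AllPairs using (AllPairs; []; _∷_)
import Data.List.Relation.Unary.AllPairs.Properties as AllPairsₚ
open import Data.List.Relation.Unary.Any as Any using (here; there)
open import Data.List.Relation.Unary.Any.Properties using (lookup-index)
open import Data.List.Membership.Propositional using (find; lose) renaming (_∈_ to _∈ₗ_)
open import Data.List.Membership.Propositional.Properties
  using (∈-lookup; ∈-map⁺; ∈-map⁻; ∈-++⁺ˡ; ∈-++⁺ʳ; ∈-++⁻; ∈-concatMap⁺; ∈-concatMap⁻)
open import Relation.Nullary using (yes; no; ¬_; Dec)
open import Relation.Nullary.Decidable using (_×-dec_)
open import Relation.Binary.PropositionalEquality
open import Relation.Binary.Bundles using (Setoid)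
open import Relation.Binary.Definitions using (tri<; tri≈; tri>)
import Relation.Binary.Reasoning.Setoid
open import Function using (id; _∘_)
open import Function.Bundles using (_⇔_; mk⇔)

AllPairs-++⁻ˡ : ∀ {a r} {A : Set a} {R : A → A → Set r} xs {ys} → AllPairs R (xs ++ ys) → AllPairs R xs
AllPairs-++⁻ˡ []       _          = []
AllPairs-++⁻ˡ (x ∷ xs) (px ∷ pxs) = Allₚ.++⁻ˡ xs px ∷ AllPairs-++⁻ˡ xs pxs

AllPairs-++⁻ʳ : ∀ {a r} {A : Set a} {R : A → A → Set r} xs {ys} → AllPairs R (xs ++ ys) → AllPairs R ys
AllPairs-++⁻ʳ []       pys        = pys
AllPairs-++⁻ʳ (x ∷ xs) (_ ∷ pxys) = AllPairs-++⁻ʳ xs pxys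

module _ {A : Set} {_≈_ : A → A → Set} (≈-sym : ∀ {x y} → x ≈ y → y ≈ x) where

  lookup-injective : ∀ {xs} → AllPairs (λ x y → ¬ x ≈ y) xs →
                     ∀ i j → List.lookup xs i ≈ List.lookup xs j → i ≡ j
  lookup-injective (_    ∷ _)       zero    zero    _   = refl
  lookup-injective (x≉xs ∷ _)       zero    (suc j) x≈y = ⊥-elim (All.lookup x≉xs (∈-lookup j) x≈y)
  lookup-injective (x≉xs ∷ _)       (suc i) zero    y≈x = ⊥-elim (All.lookup x≉xs (∈-lookup i) (≈-sym y≈x))
  lookup-injective (_    ∷ xs-dist) (suc i) (suc j) x≈y = cong suc (lookup-injective xs-dist i j x≈y)

  ∈-injective : ∀ {xs x y} → AllPairs (λ x y → ¬ x ≈ y) xs → x ∈ₗ xs → y ∈ₗ xs → x ≈ y → x ≡ y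
  ∈-injective {xs} xs-dist x∈ y∈ x≈y = begin
    _                               ≡⟨ lookup-index x∈ ⟩
    List.lookup xs (Any.index x∈)   ≡⟨ cong (List.lookup xs) (lookup-injective xs-dist _ _ lookups≈) ⟩
    List.lookup xs (Any.index y∈)   ≡⟨ lookup-index y∈ ⟨
    _                               ∎
    where
    open ≡-Reasoning
    lookups≈ = subst₂ _≈_ (lookup-index x∈) (lookup-index y∈) x≈y

  enumerate : ∀ {m} xs → AllPairs (λ x y → ¬ x ≈ y) xs → List.length xs ≡ m →
              Σ (Vec A m) λ ws → (∀ i j → lookup ws i ≈ lookup ws j → i ≡ j)
                               × (∀ {x} → x ∈ₗ xs → ∃ λ i → lookup ws i ≡ x)
  enumerate xs xs-dist refl = ws , injective , covers
    where
    ws = Vec.tabulate (List.lookup xs)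
    injective : ∀ i j → lookup ws i ≈ lookup ws j → i ≡ j
    injective i j = lookup-injective xs-dist i j ∘ subst₂ _≈_ (Vecₚ.lookup∘tabulate _ i) (Vecₚ.lookup∘tabulate _ j)
    covers : ∀ {x} → x ∈ₗ xs → ∃ λ i → lookup ws i ≡ x
    covers x∈ = Any.index x∈ , trans (Vecₚ.lookup∘tabulate _ (Any.index x∈)) (sym (lookup-index x∈))

∑ : ∀ {A : Set} → (A → ℕ) → List A → ℕ
∑ f xs = sum (List.map f xs)

∑-++ : ∀ {A : Set} (f : A → ℕ) xs ys → ∑ f (xs ++ ys) ≡ ∑ f xs + ∑ f ys
∑-++ f xs ys = trans (cong sum (map-++ f xs ys)) (sum-++ (List.map f xs) (List.map f ys))

∑-map : ∀ {A B : Set} (f : B → ℕ) (g : A → B) xs → ∑ f (List.map g xs) ≡ ∑ (f ∘ g) xs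
∑-map f g xs = cong sum (sym (map-∘ xs))

∑-cong : ∀ {A : Set} {f g : A → ℕ} → (∀ x → f x ≡ g x) → ∀ xs → ∑ f xs ≡ ∑ g xs
∑-cong f≗g xs = cong sum (map-cong f≗g xs)

∑-concatMap : ∀ {A B : Set} (f : B → ℕ) (g : A → List B) xs → ∑ f (List.concatMap g xs) ≡ ∑ (∑ f ∘ g) xs
∑-concatMap f g []       = refl
∑-concatMap f g (x ∷ xs) =
  trans (∑-++ f (g x) (List.concatMap g xs)) (cong (∑ f (g x) +_) (∑-concatMap f g xs))

length≡∑1 : ∀ {A : Set} (xs : List A) → List.length xs ≡ ∑ (λ _ → 1) xs
length≡∑1 []       = refl
length≡∑1 (_ ∷ xs) = cong suc (length≡∑1 xs)

sumTo-cong : ∀ {f g : ℕ → ℕ} → (∀ k → f k ≡ g k) → ∀ m → sumTo f m ≡ sumTo g m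
sumTo-cong f≗g zero    = f≗g 0
sumTo-cong f≗g (suc m) = cong₂ _+_ (sumTo-cong f≗g m) (f≗g (suc m))

sumTo-+ : ∀ (f g : ℕ → ℕ) m → sumTo (λ k → f k + g k) m ≡ sumTo f m + sumTo g m
sumTo-+ f g zero    = refl
sumTo-+ f g (suc m) =
  trans (cong (_+ (f (suc m) + g (suc m))) (sumTo-+ f g m))
        (interchange (sumTo f m) (sumTo g m) (f (suc m)) (g (suc m)))
  where
  interchange : ∀ a b c d → (a + b) + (c + d) ≡ (a + c) + (b + d)
  interchange = solve-∀

sumTo-head : ∀ (f : ℕ → ℕ) m → sumTo f (suc m) ≡ f 0 + sumTo (f ∘ suc) m
sumTo-head f zero    = refl
sumTo-head f (suc m) = trans (cong (_+ f (suc (suc m))) (sumTo-head f m)) (ℕₚ.+-assoc (f 0) _ _)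

stirling2-vanishes : ∀ {m k} → m ℕ.< k → stirling2 m k ≡ 0
stirling2-vanishes {zero}  {suc k} _ = refl
stirling2-vanishes {suc m} {suc k} (s≤s m<k) =
  trans (cong₂ (λ a b → suc k * a + b) (stirling2-vanishes (ℕₚ.m≤n⇒m≤1+n m<k)) (stirling2-vanishes m<k))
        (trans (ℕₚ.+-identityʳ (suc k * 0)) (ℕₚ.*-zeroʳ (suc k)))

stirling2-sum-step : ∀ n (g : ℕ → ℕ) →
  sumTo (λ k → stirling2 (suc n) (suc k) * (suc k * g k + g (suc k))) n
  ≡ sumTo (λ k → stirling2 (suc (suc n)) (suc k) * g k) (suc n)
-- The boundary terms A (suc n) and S 0 * g 0 vanish, since S(n + 1, n + 2) = S(n + 1, 0) = 0.
stirling2-sum-step n g = begin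
  sumTo (λ k → S (suc k) * (suc k * g k + g (suc k))) n
    ≡⟨ sumTo-cong (λ k → distribute (S (suc k)) (suc k) (g k) (g (suc k))) n ⟩
  sumTo (λ k → A k + B k) n
    ≡⟨ sumTo-+ A B n ⟩
  sumTo A n + sumTo B n
    ≡⟨ cong (λ a → a + sumTo B n) (trans (cong (sumTo A n +_) A-top) (ℕₚ.+-identityʳ (sumTo A n))) ⟨
  sumTo A (suc n) + sumTo B n
    ≡⟨ cong (sumTo A (suc n) +_) (sumTo-head (λ k → S k * g k) n) ⟨
  sumTo A (suc n) + sumTo (λ k → S k * g k) (suc n)
    ≡⟨ sumTo-+ A (λ k → S k * g k) (suc n) ⟨
  sumTo (λ k → A k + S k * g k) (suc n)
    ≡⟨ sumTo-cong (λ k → ℕₚ.*-distribʳ-+ (g k) (suc k * S (suc k)) (S k)) (suc n) ⟨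
  sumTo (λ k → stirling2 (suc (suc n)) (suc k) * g k) (suc n) ∎
  where
  open ≡-Reasoning
  S : ℕ → ℕ
  S = stirling2 (suc n)
  A B : ℕ → ℕ
  A k = suc k * S (suc k) * g k
  B k = S (suc k) * g (suc k)
  distribute : ∀ s k a b → s * (k * a + b) ≡ k * s * a + s * b
  distribute = solve-∀
  A-top : A (suc n) ≡ 0
  A-top = trans (cong (λ s → suc (suc n) * s * g (suc n)) (stirling2-vanishes (ℕₚ.n<1+n (suc n))))
                (cong (_* g (suc n)) (ℕₚ.*-zeroʳ (suc (suc n))))

-- The action of a letter on a column, by recursion on the alphabet

dropMin : ∀ {n} → Column n → Column n
dropMin []          = []
dropMin (true  ∷ γ) = false ∷ γ
dropMin (false ∷ γ) = false ∷ dropMin γ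

insert : ∀ {n} → Letter n → Column n → Column n
insert zero    (true  ∷ γ) = true ∷ γ
insert zero    (false ∷ γ) = true ∷ dropMin γ
insert (suc x) (b     ∷ γ) = b ∷ insert x γ

removeOpt : ∀ {n} → Maybe (Letter n) → Column n → Column n
removeOpt nothing  γ = γ
removeOpt (just y) γ = γ [ y ]≔ outside

·-removeOpt : ∀ {n} (x : Letter n) γ → x · γ ≡ removeOpt (smallestGeq x γ) γ [ x ]≔ inside
·-removeOpt x γ with smallestGeq x γ
... | nothing = refl
... | just y  = refl

-- `suc x ≤? suc y` does not reduce to `x ≤? y`, so both are decided and mismatches refuted.
firstGeq-suc : ∀ {n} (x : Letter n) b γ ys →
               firstGeq (suc x) (b ∷ γ) (List.map suc ys) ≡ Maybe.map suc (firstGeq x γ ys)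
firstGeq-suc x b γ [] = refl
firstGeq-suc x b γ (y ∷ ys)
  with suc x ≤? suc y | x ≤? y | y ∈? γ
... | yes _   | yes _   | yes _ = refl
... | no x≰y  | yes x≤y | _     = ⊥-elim (x≰y (s≤s x≤y))
... | yes x≤y | no x≰y  | _     = ⊥-elim (x≰y (ℕ.s≤s⁻¹ x≤y))
... | no _    | no _    | _     = firstGeq-suc x b γ ys
... | yes _   | yes _   | no _  = firstGeq-suc x b γ ys

firstGeq-zero : ∀ {n} b c (γ : Column n) ys →
                firstGeq zero (b ∷ c ∷ γ) (List.map suc ys) ≡ Maybe.map suc (firstGeq zero (c ∷ γ) ys)
firstGeq-zero b c γ [] = refl
firstGeq-zero b c γ (y ∷ ys) with y ∈? (c ∷ γ)
... | yes _ = refl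
... | no _  = firstGeq-zero b c γ ys

tabulate-suc : ∀ n → tabulate {n = n} Fin.suc ≡ List.map Fin.suc (allFin n)
tabulate-suc n = sym (map-tabulate id Fin.suc)

smallestGeq-suc : ∀ {n} (x : Letter n) b γ → smallestGeq (suc x) (b ∷ γ) ≡ Maybe.map suc (smallestGeq x γ)
smallestGeq-suc {n} x b γ = trans (cong (firstGeq (suc x) (b ∷ γ)) (tabulate-suc n)) (firstGeq-suc x b γ (allFin n))

smallestGeq-zero-false : ∀ {n} c (γ : Column n) →
                         smallestGeq zero (false ∷ c ∷ γ) ≡ Maybe.map suc (smallestGeq zero (c ∷ γ))
smallestGeq-zero-false {n} c γ =
  trans (cong (firstGeq zero (false ∷ c ∷ γ)) (tabulate-suc (suc n))) (firstGeq-zero false c γ (allFin (suc n)))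

removeOpt-map-suc : ∀ {n} b (γ : Column n) m → removeOpt (Maybe.map suc m) (b ∷ γ) ≡ b ∷ removeOpt m γ
removeOpt-map-suc b γ nothing  = refl
removeOpt-map-suc b γ (just y) = refl

removeOpt-smallestGeq-zero : ∀ {n} (γ : Column (suc n)) → removeOpt (smallestGeq zero γ) γ ≡ dropMin γ
removeOpt-smallestGeq-zero (true  ∷ γ)     = refl
removeOpt-smallestGeq-zero (false ∷ [])    = refl
removeOpt-smallestGeq-zero (false ∷ c ∷ γ) = begin
  removeOpt (smallestGeq zero (false ∷ c ∷ γ)) (false ∷ c ∷ γ)
    ≡⟨ cong (λ m → removeOpt m (false ∷ c ∷ γ)) (smallestGeq-zero-false c γ) ⟩
  removeOpt (Maybe.map suc (smallestGeq zero (c ∷ γ))) (false ∷ c ∷ γ)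
    ≡⟨ removeOpt-map-suc false (c ∷ γ) (smallestGeq zero (c ∷ γ)) ⟩
  false ∷ removeOpt (smallestGeq zero (c ∷ γ)) (c ∷ γ)
    ≡⟨ cong (false ∷_) (removeOpt-smallestGeq-zero (c ∷ γ)) ⟩
  false ∷ dropMin (c ∷ γ) ∎
  where open ≡-Reasoning

insert-zero : ∀ {n} (γ : Column (suc n)) → insert zero γ ≡ dropMin γ [ zero ]≔ inside
insert-zero (true  ∷ γ) = refl
insert-zero (false ∷ γ) = refl

·≡insert : ∀ {n} (x : Letter n) γ → x · γ ≡ insert x γ
·≡insert zero γ = begin
  zero · γ                                          ≡⟨ ·-removeOpt zero γ ⟩
  removeOpt (smallestGeq zero γ) γ [ zero ]≔ inside ≡⟨ cong (_[ zero ]≔ inside) (removeOpt-smallestGeq-zero γ) ⟩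
  dropMin γ [ zero ]≔ inside                        ≡⟨ insert-zero γ ⟨
  insert zero γ                                     ∎
  where open ≡-Reasoning
·≡insert (suc x) (b ∷ γ) = begin
  suc x · (b ∷ γ)
    ≡⟨ ·-removeOpt (suc x) (b ∷ γ) ⟩
  removeOpt (smallestGeq (suc x) (b ∷ γ)) (b ∷ γ) [ suc x ]≔ inside
    ≡⟨ cong (λ m → removeOpt m (b ∷ γ) [ suc x ]≔ inside) (smallestGeq-suc x b γ) ⟩
  removeOpt (Maybe.map suc (smallestGeq x γ)) (b ∷ γ) [ suc x ]≔ inside
    ≡⟨ cong (_[ suc x ]≔ inside) (removeOpt-map-suc b γ (smallestGeq x γ)) ⟩
  b ∷ (removeOpt (smallestGeq x γ) γ [ x ]≔ inside)
    ≡⟨ cong (b ∷_) (sym (·-removeOpt x γ)) ⟩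
  b ∷ (x · γ)
    ≡⟨ cong (b ∷_) (·≡insert x γ) ⟩
  b ∷ insert x γ ∎
  where open ≡-Reasoning

run : ∀ {n} → Word n → Column n → Column n
run w γ = foldr insert γ w

act≡run : ∀ {n} (w : Word n) γ → act w γ ≡ run w γ
act≡run []      γ = refl
act≡run (x ∷ w) γ = trans (cong (x ·_) (act≡run w γ)) (·≡insert x (run w γ))

infix 4 _≐_
_≐_ : ∀ {n} → Word n → Word n → Set
u ≐ v = ∀ γ → run u γ ≡ run v γ

≡styl⇒≐ : ∀ {n} (u v : Word n) → u ≡styl v → u ≐ v
≡styl⇒≐ u v eq γ = trans (sym (act≡run u γ)) (trans (eq γ) (act≡run v γ))

≐⇒≡styl : ∀ {n} (u v : Word n) → u ≐ v → u ≡styl v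
≐⇒≡styl u v eq γ = trans (act≡run u γ) (trans (eq γ) (sym (act≡run v γ)))

run-++ : ∀ {n} (u v : Word n) γ → run (u ++ v) γ ≡ run u (run v γ)
run-++ u v γ = foldr-++ insert γ u v

-- The defining relations hold in Styl(A)

insert-idem : ∀ {n} (x : Letter n) γ → insert x (insert x γ) ≡ insert x γ
insert-idem zero    (true  ∷ γ) = refl
insert-idem zero    (false ∷ γ) = refl
insert-idem (suc x) (b     ∷ γ) = cong (b ∷_) (insert-idem x γ)

dropMin²-insert : ∀ {n} (x : Letter n) γ → dropMin (dropMin (insert x γ)) ≡ dropMin (insert x (dropMin γ))
dropMin²-insert zero    (true  ∷ γ) = refl
dropMin²-insert zero    (false ∷ γ) = refl
dropMin²-insert (suc x) (true  ∷ γ) = refl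
dropMin²-insert (suc x) (false ∷ γ) = cong (false ∷_) (dropMin²-insert x γ)

insert-dropMin-insert-self : ∀ {n} (x : Letter n) γ → insert x (dropMin γ) ≡ insert x (dropMin (insert x γ))
insert-dropMin-insert-self zero    (true  ∷ γ) = refl
insert-dropMin-insert-self zero    (false ∷ γ) = refl
insert-dropMin-insert-self (suc x) (true  ∷ γ) = cong (false ∷_) (sym (insert-idem x γ))
insert-dropMin-insert-self (suc x) (false ∷ γ) = cong (false ∷_) (insert-dropMin-insert-self x γ)

dropMin-insert-insert : ∀ {n} (y x : Letter n) γ → y Fin.< x →
                        dropMin (insert x (insert y γ)) ≡ insert x (dropMin (insert y γ))
dropMin-insert-insert zero    (suc x) (true  ∷ γ) _ = refl
dropMin-insert-insert zero    (suc x) (false ∷ γ) _ = refl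
dropMin-insert-insert (suc y) (suc x) (true  ∷ γ) _ = refl
dropMin-insert-insert (suc y) (suc x) (false ∷ γ) (s≤s y<x) = cong (false ∷_) (dropMin-insert-insert y x γ y<x)

insert-dropMin-insert : ∀ {n} (y x : Letter n) γ → y Fin.< x →
                        insert y (dropMin (insert x γ)) ≡ insert y (insert x (dropMin γ))
insert-dropMin-insert zero    (suc x) (true  ∷ γ) _ = refl
insert-dropMin-insert zero    (suc x) (false ∷ γ) _ = cong (true ∷_) (dropMin²-insert x γ)
insert-dropMin-insert (suc y) (suc x) (true  ∷ γ) _ = refl
insert-dropMin-insert (suc y) (suc x) (false ∷ γ) (s≤s y<x) = cong (false ∷_) (insert-dropMin-insert y x γ y<x)

insert-bac : ∀ {n} (a b c : Letter n) γ → a Fin.< b → b Fin.< c →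
             insert b (insert a (insert c γ)) ≡ insert b (insert c (insert a γ))
insert-bac zero    (suc b) (suc c) (true  ∷ γ) _ _ = refl
insert-bac zero    (suc b) (suc c) (false ∷ γ) _ (s≤s b<c) = cong (true ∷_) (insert-dropMin-insert b c γ b<c)
insert-bac (suc a) (suc b) (suc c) (β ∷ γ) (s≤s a<b) (s≤s b<c) = cong (β ∷_) (insert-bac a b c γ a<b b<c)

insert-acb : ∀ {n} (a b c : Letter n) γ → a Fin.< b → b Fin.< c →
             insert a (insert c (insert b γ)) ≡ insert c (insert a (insert b γ))
insert-acb zero    (suc b) (suc c) (true  ∷ γ) _ _ = refl
insert-acb zero    (suc b) (suc c) (false ∷ γ) _ (s≤s b<c) = cong (true ∷_) (dropMin-insert-insert b c γ b<c)
insert-acb (suc a) (suc b) (suc c) (β ∷ γ) (s≤s a<b) (s≤s b<c) = cong (β ∷_) (insert-acb a b c γ a<b b<c)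

insert-baa : ∀ {n} (a b : Letter n) γ → a Fin.< b → insert b (insert a (insert a γ)) ≡ insert a (insert b (insert a γ))
insert-baa zero    (suc b) (true  ∷ γ) _ = refl
insert-baa zero    (suc b) (false ∷ γ) _ = refl
insert-baa (suc a) (suc b) (β ∷ γ) (s≤s a<b) = cong (β ∷_) (insert-baa a b γ a<b)

insert-bba : ∀ {n} (a b : Letter n) γ → a Fin.< b → insert b (insert b (insert a γ)) ≡ insert b (insert a (insert b γ))
insert-bba zero    (suc b) (true  ∷ γ) _ = refl
insert-bba zero    (suc b) (false ∷ γ) _ =
  cong (true ∷_) (trans (insert-idem b (dropMin γ)) (insert-dropMin-insert-self b γ))
insert-bba (suc a) (suc b) (β ∷ γ) (s≤s a<b) = cong (β ∷_) (insert-bba a b γ a<b)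

Rel⇒≐ : ∀ {n} {l r : Word n} → Rel l r → l ≐ r
Rel⇒≐ (pl₁ a<b b<c) γ = insert-bac _ _ _ γ a<b b<c
Rel⇒≐ (pl₂ a<b b<c) γ = insert-acb _ _ _ γ a<b b<c
Rel⇒≐ (pl₃ a<b)     γ = insert-baa _ _ γ a<b
Rel⇒≐ (pl₄ a<b)     γ = insert-bba _ _ γ a<b
Rel⇒≐ idem          γ = insert-idem _ γ

~⇒≐ : ∀ {n} {u v : Word n} → u ~ v → u ≐ v
~⇒≐ (step {l} {r} u v lRr) γ = begin
  run (u ++ l ++ v) γ     ≡⟨ run-++ u (l ++ v) γ ⟩
  run u (run (l ++ v) γ)  ≡⟨ cong (run u) (run-++ l v γ) ⟩
  run u (run l (run v γ)) ≡⟨ cong (run u) (Rel⇒≐ lRr (run v γ)) ⟩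
  run u (run r (run v γ)) ≡⟨ cong (run u) (run-++ r v γ) ⟨
  run u (run (r ++ v) γ)  ≡⟨ run-++ u (r ++ v) γ ⟨
  run (u ++ r ++ v) γ     ∎
  where open ≡-Reasoning
~⇒≐ ~refl            γ = refl
~⇒≐ (~sym u~v)       γ = sym (~⇒≐ u~v γ)
~⇒≐ (~trans u~v v~w) γ = trans (~⇒≐ u~v γ) (~⇒≐ v~w γ)

∈dropMin : ∀ {n} {γ : Column n} {w z} → w ∈ γ → w Fin.< z → z ∈ γ → z ∈ dropMin γ
∈dropMin {γ = true  ∷ γ} _           _         (there z∈γ) = there z∈γ
∈dropMin {γ = false ∷ γ} (there w∈γ) (s≤s w<z) (there z∈γ) = there (∈dropMin w∈γ w<z z∈γ)

∈dropMin⁻ : ∀ {n} {γ : Column n} {z} → z ∈ dropMin γ → z ∈ γ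
∈dropMin⁻ {γ = true  ∷ γ} (there z∈γ) = there z∈γ
∈dropMin⁻ {γ = false ∷ γ} (there z∈γ) = there (∈dropMin⁻ z∈γ)

∈dropMin⇒∃< : ∀ {n} {γ : Column n} {z} → z ∈ dropMin γ → ∃ λ w → w ∈ γ × w Fin.< z
∈dropMin⇒∃< {γ = true  ∷ γ} (there _) = zero , here , s≤s z≤n
∈dropMin⇒∃< {γ = false ∷ γ} (there z∈γ) with ∈dropMin⇒∃< z∈γ
... | w , w∈γ , w<z = suc w , there w∈γ , s≤s w<z

min∉dropMin : ∀ {n} {γ : Column n} {y} → y ∈ γ → (∀ {s} → s ∈ γ → y Fin.≤ s) → y ∉ dropMin γ
min∉dropMin {γ = true  ∷ γ} here        _   ()
min∉dropMin {γ = true  ∷ γ} (there _)   min _ with min here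
... | ()
min∉dropMin {γ = false ∷ γ} (there y∈γ) min (there y∈dγ) =
  min∉dropMin y∈γ (λ s∈γ → ℕ.s≤s⁻¹ (min (there s∈γ))) y∈dγ

∈insert : ∀ {n} (x : Letter n) γ → x ∈ insert x γ
∈insert zero    (true  ∷ γ) = here
∈insert zero    (false ∷ γ) = here
∈insert (suc x) (b     ∷ γ) = there (∈insert x γ)

∈insert-below : ∀ {n} {x z : Letter n} {γ} → z ∈ γ → z Fin.< x → z ∈ insert x γ
∈insert-below {x = suc x} {γ = b ∷ γ} here        _         = here
∈insert-below {x = suc x} {γ = b ∷ γ} (there z∈γ) (s≤s z<x) = there (∈insert-below z∈γ z<x)

∈insert⁻ : ∀ {n} {x z : Letter n} {γ} → z ∈ insert x γ → z ≢ x → z ∈ γ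
∈insert⁻ {x = zero}  {γ = true  ∷ γ} here        z≢x = ⊥-elim (z≢x refl)
∈insert⁻ {x = zero}  {γ = false ∷ γ} here        z≢x = ⊥-elim (z≢x refl)
∈insert⁻ {x = zero}  {γ = true  ∷ γ} (there z∈γ) _   = there z∈γ
∈insert⁻ {x = zero}  {γ = false ∷ γ} (there z∈γ) _   = there (∈dropMin⁻ z∈γ)
∈insert⁻ {x = suc x} {γ = b ∷ γ}     here        _   = here
∈insert⁻ {x = suc x} {γ = b ∷ γ}     (there z∈γ) z≢x = there (∈insert⁻ z∈γ (z≢x ∘ cong suc))

∈insert-above : ∀ {n} {x y z : Letter n} {γ} → z ∈ γ → y ∈ γ → x Fin.≤ y → y Fin.< z → z ∈ insert x γ
∈insert-above {x = zero}  {γ = true  ∷ γ} z∈γ         _           _         _         = z∈γ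
∈insert-above {x = zero}  {γ = false ∷ γ} (there z∈γ) (there y∈γ) _         (s≤s y<z) = there (∈dropMin y∈γ y<z z∈γ)
∈insert-above {x = suc x} {γ = b ∷ γ}     (there z∈γ) (there y∈γ) (s≤s x≤y) (s≤s y<z) = there (∈insert-above z∈γ y∈γ x≤y y<z)

∈insert-above⁻ : ∀ {n} {x z : Letter n} {γ} → z ∈ insert x γ → x Fin.< z → ∃ λ y → y ∈ γ × x Fin.≤ y × y Fin.< z
∈insert-above⁻ {x = zero} {z = suc z} {γ = true ∷ γ} _ _ = zero , here , z≤n , s≤s z≤n
∈insert-above⁻ {x = zero}  {γ = false ∷ γ} (there z∈γ) _         with ∈dropMin⇒∃< z∈γ
... | w , w∈γ , w<z = suc w , there w∈γ , z≤n , s≤s w<z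
∈insert-above⁻ {x = suc x} {γ = b ∷ γ}     (there z∈γ) (s≤s x<z) with ∈insert-above⁻ z∈γ x<z
... | y , y∈γ , x≤y , y<z = suc y , there y∈γ , s≤s x≤y , s≤s y<z

bumped∉insert : ∀ {n} {x y : Letter n} {γ} → y ∈ γ → x Fin.< y → (∀ {s} → s ∈ γ → x Fin.≤ s → y Fin.≤ s) →
                y ∉ insert x γ
bumped∉insert {x = zero} {y = suc y} {γ = true ∷ γ} _ _ min _ with min here z≤n
... | ()
bumped∉insert {x = zero}  {γ = false ∷ γ} (there y∈γ) _         min (there y∈dγ) =
  min∉dropMin y∈γ (λ s∈γ → ℕ.s≤s⁻¹ (min (there s∈γ) z≤n)) y∈dγ
bumped∉insert {x = suc x} {γ = b ∷ γ}     (there y∈γ) (s≤s x<y) min (there y∈iγ) =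
  bumped∉insert y∈γ x<y (λ s∈γ x≤s → ℕ.s≤s⁻¹ (min (there s∈γ) (s≤s x≤s))) y∈iγ

-- Rewriting modulo the relations

~-setoid : ℕ → Setoid _ _
~-setoid n = record
  { Carrier       = Word n
  ; _≈_           = _~_
  ; isEquivalence = record { refl = ~refl ; sym = ~sym ; trans = ~trans }
  }

module ~-Reasoning {n : ℕ} = Relation.Binary.Reasoning.Setoid (~-setoid n)

≡⇒~ : ∀ {n} {u v : Word n} → u ≡ v → u ~ v
≡⇒~ refl = ~refl

rel : ∀ {n} {l r : Word n} (s : Word n) → Rel l r → (l ++ s) ~ (r ++ s)
rel s = step [] s

~-++ˡ : ∀ {n} (p : Word n) {u v} → u ~ v → (p ++ u) ~ (p ++ v)
~-++ˡ p (step {l} {r} u v lRr) =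
  subst₂ _~_ (++-assoc p u (l ++ v)) (++-assoc p u (r ++ v)) (step (p ++ u) v lRr)
~-++ˡ p ~refl            = ~refl
~-++ˡ p (~sym u~v)       = ~sym (~-++ˡ p u~v)
~-++ˡ p (~trans u~v v~w) = ~trans (~-++ˡ p u~v) (~-++ˡ p v~w)

~-∷ : ∀ {n} (x : Letter n) {u v} → u ~ v → (x ∷ u) ~ (x ∷ v)
~-∷ x = ~-++ˡ (x ∷ [])

shift : ∀ {n} → Word n → Word (suc n)
shift = List.map suc

Rel-shift : ∀ {n} {l r : Word n} → Rel l r → Rel (shift l) (shift r)
Rel-shift (pl₁ a<b b<c) = pl₁ (s≤s a<b) (s≤s b<c)
Rel-shift (pl₂ a<b b<c) = pl₂ (s≤s a<b) (s≤s b<c)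
Rel-shift (pl₃ a<b)     = pl₃ (s≤s a<b)
Rel-shift (pl₄ a<b)     = pl₄ (s≤s a<b)
Rel-shift idem          = idem

~-shift : ∀ {n} {u v : Word n} → u ~ v → shift u ~ shift v
~-shift (step {l} {r} u v lRr) =
  subst₂ _~_ (shift-++³ l) (shift-++³ r) (step (shift u) (shift v) (Rel-shift lRr))
  where
  shift-++³ : ∀ l → shift u ++ shift l ++ shift v ≡ shift (u ++ l ++ v)
  shift-++³ l = sym (trans (map-++ suc u (l ++ v)) (cong (shift u ++_) (map-++ suc l v)))
~-shift ~refl            = ~refl
~-shift (~sym u~v)       = ~sym (~-shift u~v)
~-shift (~trans u~v v~w) = ~trans (~-shift u~v) (~-shift v~w)

run-shift : ∀ {n} (w : Word n) b γ → run (shift w) (b ∷ γ) ≡ b ∷ run w γ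
run-shift []      b γ = refl
run-shift (x ∷ w) b γ = cong (insert (suc x)) (run-shift w b γ)

col : ∀ {n} → Word n → Column n
col {n} w = run w ∅

swap-over : ∀ {n} {w : Word n} {a y x} → (y ∷ w) ~ w → a Fin.< y → y Fin.< x → (x ∷ a ∷ w) ~ (a ∷ x ∷ w)
swap-over {w = w} {a} {y} {x} yw~w a<y y<x = begin
  x ∷ a ∷ w      ≈⟨ ~-∷ x (~-∷ a yw~w) ⟨
  x ∷ a ∷ y ∷ w  ≈⟨ rel w (pl₂ a<y y<x) ⟨
  a ∷ x ∷ y ∷ w  ≈⟨ ~-∷ a (~-∷ x yw~w) ⟩
  a ∷ x ∷ w      ∎
  where open ~-Reasoning

absorb : ∀ {n} (w : Word n) {x} → x ∈ col w → (x ∷ w) ~ w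
absorb []      x∈∅ = ⊥-elim (∉⊥ x∈∅)
absorb (z ∷ w) {x} x∈col with Finₚ.<-cmp x z
... | tri≈ _ refl _ = rel w idem
... | tri< x<z _ _  = begin
  x ∷ z ∷ w      ≈⟨ ~-∷ x (~-∷ z xw~w) ⟨
  x ∷ z ∷ x ∷ w  ≈⟨ rel w (pl₃ x<z) ⟨
  z ∷ x ∷ x ∷ w  ≈⟨ ~-∷ z (rel w idem) ⟩
  z ∷ x ∷ w      ≈⟨ ~-∷ z xw~w ⟩
  z ∷ w          ∎
  where
  open ~-Reasoning
  xw~w = absorb w (∈insert⁻ x∈col (Finₚ.<⇒≢ x<z))
... | tri> _ _ z<x with ∈insert-above⁻ x∈col z<x
...   | y , y∈col , z≤y , y<x = begin
  x ∷ z ∷ w  ≈⟨ x-past-z ⟩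
  z ∷ x ∷ w  ≈⟨ ~-∷ z (absorb w (∈insert⁻ x∈col (Finₚ.<⇒≢ z<x ∘ sym))) ⟩
  z ∷ w      ∎
  where
  open ~-Reasoning
  yw~w = absorb w y∈col
  x-past-z : (x ∷ z ∷ w) ~ (z ∷ x ∷ w)
  x-past-z with Finₚ.<-cmp z y
  ... | tri< z<y _ _  = swap-over yw~w z<y y<x
  ... | tri≈ _ refl _ = begin
    x ∷ z ∷ w      ≈⟨ ~-∷ x (~-∷ z yw~w) ⟨
    x ∷ z ∷ z ∷ w  ≈⟨ rel w (pl₃ z<x) ⟩
    z ∷ x ∷ z ∷ w  ≈⟨ ~-∷ z (~-∷ x yw~w) ⟩
    z ∷ x ∷ w      ∎
  ... | tri> _ _ y<z  = ⊥-elim (ℕₚ.<⇒≱ y<z z≤y)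

absorb-all : ∀ {n} D (w : Word n) → All (_∈ col w) D → (D ++ w) ~ w
absorb-all []      w []              = ~refl
absorb-all (d ∷ D) w (d∈col ∷ D⊆col) = ~trans (~-∷ d (absorb-all D w D⊆col)) (absorb w d∈col)

Decreasing : ∀ {n} → Word n → Set
Decreasing = AllPairs Fin._>_

decreasing-shift : ∀ {n} {D : Word n} → Decreasing D → Decreasing (shift D)
decreasing-shift = AllPairsₚ.map⁺ ∘ AllPairs.map s≤s

decreasing-shift⁻ : ∀ {n} {D : Word n} → Decreasing (shift D) → Decreasing D
decreasing-shift⁻ = AllPairs.map ℕ.s≤s⁻¹ ∘ AllPairsₚ.map⁻

zero<shift : ∀ {n} (D : Word n) → All (zero {n} Fin.<_) (shift D)
zero<shift []      = []
zero<shift (_ ∷ D) = s≤s z≤n ∷ zero<shift D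

decreasing-∷ʳzero : ∀ {n} {D : Word n} → Decreasing D → Decreasing (shift D ∷ʳ zero)
decreasing-∷ʳzero {D = D} D-decr =
  AllPairsₚ.++⁺ (decreasing-shift D-decr) ([] ∷ []) (All.map (_∷ []) (zero<shift D))

decreasing-∷ʳzero⁻ : ∀ {n} {D : Word n} → Decreasing (shift D ∷ʳ zero) → Decreasing D
decreasing-∷ʳzero⁻ {D = D} = decreasing-shift⁻ ∘ AllPairs-++⁻ˡ (shift D)

decreasing-above : ∀ {n} (U : Word n) {y L} → Decreasing (U ++ y ∷ L) → All (y Fin.<_) U
decreasing-above []      _              = []
decreasing-above (u ∷ U) (U<u ∷ U-decr) = All.head (Allₚ.++⁻ʳ U U<u) ∷ decreasing-above U U-decr

decreasing-replace : ∀ {n} (U : Word n) {x y L} → Decreasing (U ++ y ∷ L) → x Fin.< y → All (Fin._< x) L →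
                     Decreasing (U ++ x ∷ L)
decreasing-replace []      (_ ∷ L-decr)   _   L<x = L<x ∷ L-decr
decreasing-replace (u ∷ U) (U<u ∷ U-decr) x<y L<x with Allₚ.++⁻ U U<u
... | U<u′ , y<u ∷ L<u = Allₚ.++⁺ U<u′ (Finₚ.<-trans x<y y<u ∷ L<u) ∷ decreasing-replace U U-decr x<y L<x

absorb-after-larger : ∀ {n} {a : Letter n} u r → All (a Fin.<_) u → (a ∷ u ++ a ∷ r) ~ (u ++ a ∷ r)
absorb-after-larger {a = a} []      r []           = rel r idem
absorb-after-larger {a = a} (x ∷ u) r (a<x ∷ a<u) = begin
  a ∷ x ∷ u ++ a ∷ r      ≈⟨ ~-∷ a (~-∷ x aua~ua) ⟨
  a ∷ x ∷ a ∷ u ++ a ∷ r  ≈⟨ rel (u ++ a ∷ r) (pl₃ a<x) ⟨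
  x ∷ a ∷ a ∷ u ++ a ∷ r  ≈⟨ ~-∷ x (rel (u ++ a ∷ r) idem) ⟩
  x ∷ a ∷ u ++ a ∷ r      ≈⟨ ~-∷ x aua~ua ⟩
  x ∷ u ++ a ∷ r          ∎
  where
  open ~-Reasoning
  aua~ua = absorb-after-larger u r a<u

Passable : ∀ {n} → Letter n → Word n → Word n → Set
Passable x []      w = ⊤
Passable x (d ∷ D) w = (∃ λ y → y ∈ col (D ++ w) × d Fin.< y × y Fin.< x) × Passable x D w

pass : ∀ {n} {x : Letter n} D w → Passable x D w → (x ∷ D ++ w) ~ (D ++ x ∷ w)
pass []      w _ = ~refl
pass (d ∷ D) w ((y , y∈col , d<y , y<x) , D-passable) =
  ~trans (swap-over (absorb (D ++ w) y∈col) d<y y<x) (~-∷ d (pass D w D-passable))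

absorb-across : ∀ {n} {x d : Letter n} D w → d Fin.< x → Passable x D w →
                (x ∷ d ∷ D ++ x ∷ w) ~ (x ∷ d ∷ D ++ w)
absorb-across {x = x} {d} D w d<x D-passable = begin
  x ∷ d ∷ D ++ x ∷ w  ≈⟨ ~-∷ x (~-∷ d (pass D w D-passable)) ⟨
  x ∷ d ∷ x ∷ D ++ w  ≈⟨ rel (D ++ w) (pl₄ d<x) ⟨
  x ∷ x ∷ d ∷ D ++ w  ≈⟨ rel (d ∷ D ++ w) idem ⟩
  x ∷ d ∷ D ++ w      ∎
  where open ~-Reasoning

pass-above : ∀ {n} {x y : Letter n} U r → x Fin.< y → Decreasing U → All (y Fin.<_) U →
             (x ∷ U ++ y ∷ r) ~ (U ++ x ∷ y ∷ r)
pass-above []          r x<y _                      _             = ~refl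
pass-above (u ∷ [])    r x<y _                      (y<u ∷ [])    = rel r (pl₂ x<y y<u)
pass-above (u ∷ b ∷ U) r x<y ((b<u ∷ _) ∷ b∷U-decr) (_ ∷ y<b∷U) =
  ~trans (rel (U ++ _ ∷ r) (pl₂ (Finₚ.<-trans x<y (All.head y<b∷U)) b<u))
         (~-∷ u (pass-above (b ∷ U) r x<y b∷U-decr y<b∷U))

hop-below : ∀ {n} {b y : Letter n} L r → All (Fin._< b) L → b Fin.< y → Decreasing L →
            (b ∷ y ∷ L ++ r) ~ (b ∷ L ++ y ∷ r)
hop-below []      r _           _   _              = ~refl
hop-below (l ∷ L) r (l<b ∷ L<b) b<y (L<l ∷ L-decr) =
  ~trans (~sym (rel (L ++ r) (pl₁ l<b b<y))) (~-∷ _ (hop-below L r L<l (Finₚ.<-trans l<b b<y) L-decr))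

record IsSegment {n} (D : Word n) (Y : Column n) : Set where
  field
    decreasing : Decreasing D
    ⊆column    : All (_∈ Y) D
    downClosed : ∀ {z d} → z ∈ Y → d ∈ₗ D → z Fin.≤ d → z ∈ₗ D

segments : ∀ {n} → Column n → List (Word n)
segments []          = [] ∷ []
segments (true  ∷ Y) = [] ∷ List.map (λ D → shift D ∷ʳ zero) (segments Y)
segments (false ∷ Y) = List.map shift (segments Y)

∈shift⁻ : ∀ {n} {z : Letter n} {D} → suc z ∈ₗ shift D → z ∈ₗ D
∈shift⁻ {D = D} sz∈ with ∈-map⁻ suc sz∈
... | _ , z∈D , refl = z∈D

module _ {n} {D : Word n} {Y : Column n} where
  open IsSegment

  IsSegment-shift : IsSegment D Y → IsSegment (shift D) (false ∷ Y)
  IsSegment-shift D-seg = record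
    { decreasing = decreasing-shift (decreasing D-seg)
    ; ⊆column    = gmap⁺ there (⊆column D-seg)
    ; downClosed = closed
    }
    where
    closed : ∀ {z d} → z ∈ false ∷ Y → d ∈ₗ shift D → z Fin.≤ d → z ∈ₗ shift D
    closed (there z∈Y) d∈ z≤d with ∈-map⁻ suc d∈
    ... | _ , d∈D , refl = ∈-map⁺ suc (downClosed D-seg z∈Y d∈D (ℕ.s≤s⁻¹ z≤d))

  IsSegment-shift⁻ : IsSegment (shift D) (false ∷ Y) → IsSegment D Y
  IsSegment-shift⁻ D-seg = record
    { decreasing = decreasing-shift⁻ (decreasing D-seg)
    ; ⊆column    = gmap⁻ drop-there (⊆column D-seg)
    ; downClosed = λ z∈Y d∈D z≤d → ∈shift⁻ (downClosed D-seg (there z∈Y) (∈-map⁺ suc d∈D) (s≤s z≤d))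
    }

  IsSegment-∷ʳzero : IsSegment D Y → IsSegment (shift D ∷ʳ zero) (true ∷ Y)
  IsSegment-∷ʳzero D-seg = record
    { decreasing = decreasing-∷ʳzero (decreasing D-seg)
    ; ⊆column    = Allₚ.++⁺ (gmap⁺ there (⊆column D-seg)) (here ∷ [])
    ; downClosed = closed
    }
    where
    closed : ∀ {z d} → z ∈ true ∷ Y → d ∈ₗ shift D ∷ʳ zero → z Fin.≤ d → z ∈ₗ shift D ∷ʳ zero
    closed here        _  _ = ∈-++⁺ʳ (shift D) (here refl)
    closed (there z∈Y) d∈ z≤d with ∈-++⁻ (shift D) d∈
    ... | inj₂ (here refl) = ⊥-elim (ℕₚ.<⇒≱ (s≤s z≤n) z≤d)
    ... | inj₁ d∈shift with ∈-map⁻ suc d∈shift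
    ...   | _ , d∈D , refl = ∈-++⁺ˡ (∈-map⁺ suc (downClosed D-seg z∈Y d∈D (ℕ.s≤s⁻¹ z≤d)))

  IsSegment-∷ʳzero⁻ : IsSegment (shift D ∷ʳ zero) (true ∷ Y) → IsSegment D Y
  IsSegment-∷ʳzero⁻ D-seg = record
    { decreasing = decreasing-∷ʳzero⁻ (decreasing D-seg)
    ; ⊆column    = gmap⁻ drop-there (Allₚ.++⁻ˡ (shift D) (⊆column D-seg))
    ; downClosed = closed
    }
    where
    closed : ∀ {z d} → z ∈ Y → d ∈ₗ D → z Fin.≤ d → z ∈ₗ D
    closed z∈Y d∈D z≤d with ∈-++⁻ (shift D) (downClosed D-seg (there z∈Y) (∈-++⁺ˡ (∈-map⁺ suc d∈D)) (s≤s z≤d))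
    ... | inj₁ sz∈shift = ∈shift⁻ sz∈shift
    ... | inj₂ (here ())

[]-IsSegment : ∀ {n} (Y : Column n) → IsSegment [] Y
[]-IsSegment Y = record { decreasing = [] ; ⊆column = [] ; downClosed = λ { _ () _ } }

∈segments⇒IsSegment : ∀ {n} (Y : Column n) {D} → D ∈ₗ segments Y → IsSegment D Y
∈segments⇒IsSegment []          (here refl) = []-IsSegment []
∈segments⇒IsSegment (true  ∷ Y) (here refl) = []-IsSegment (true ∷ Y)
∈segments⇒IsSegment (true  ∷ Y) (there D∈) with ∈-map⁻ (λ D → shift D ∷ʳ zero) D∈
... | D′ , D′∈ , refl = IsSegment-∷ʳzero (∈segments⇒IsSegment Y D′∈)
∈segments⇒IsSegment (false ∷ Y) D∈ with ∈-map⁻ shift D∈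
... | D′ , D′∈ , refl = IsSegment-shift (∈segments⇒IsSegment Y D′∈)

ending-in-zero : ∀ {n} (D : Word (suc n)) → Decreasing D → zero ∈ₗ D → ∃ λ D′ → D ≡ shift D′ ∷ʳ zero
ending-in-zero (zero  ∷ [])    _               _          = [] , refl
ending-in-zero (zero  ∷ _ ∷ _) ((() ∷ _) ∷ _)  _
ending-in-zero (suc d ∷ D)     (_ ∷ D-decr)    (there 0∈D) with ending-in-zero D D-decr 0∈D
... | D′ , refl = d ∷ D′ , refl

avoiding-zero : ∀ {n} {Y : Column n} (D : Word (suc n)) → All (_∈ false ∷ Y) D → ∃ λ D′ → D ≡ shift D′
avoiding-zero []          []                 = [] , refl
avoiding-zero (suc d ∷ D) (_ ∷ D⊆) with avoiding-zero D D⊆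
... | D′ , refl = d ∷ D′ , refl

IsSegment⇒∈segments : ∀ {n} (Y : Column n) {D} → IsSegment D Y → D ∈ₗ segments Y
IsSegment⇒∈segments []          {[]}    _     = here refl
IsSegment⇒∈segments (true  ∷ Y) {[]}    _     = here refl
IsSegment⇒∈segments (true  ∷ Y) {d ∷ D} D-seg
  with ending-in-zero (d ∷ D) (decreasing D-seg) (downClosed D-seg here (here refl) z≤n)
  where open IsSegment
... | D′ , eq rewrite eq =
  there (∈-map⁺ (λ D → shift D ∷ʳ zero) (IsSegment⇒∈segments Y (IsSegment-∷ʳzero⁻ D-seg)))
IsSegment⇒∈segments (false ∷ Y) {D} D-seg with avoiding-zero D (IsSegment.⊆column D-seg)
... | D′ , refl = ∈-map⁺ shift (IsSegment⇒∈segments Y (IsSegment-shift⁻ D-seg))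

data Split {n} (x : Letter n) : Word n → Set where
  member  : ∀ {D} → x ∈ₗ D → Split x D
  exceeds : ∀ {D} → All (Fin._< x) D → Split x D
  bumps   : ∀ U {y} L → x Fin.< y → All (Fin._< x) L → Split x (U ++ y ∷ L)

split : ∀ {n} (x : Letter n) {D} → Decreasing D → Split x D
split x {[]}    _ = exceeds []
split x {d ∷ D} (D<d ∷ D-decr) with Finₚ.<-cmp x d
... | tri≈ _ refl _ = member (here refl)
... | tri> _ _ d<x  = exceeds (d<x ∷ All.map (λ e<d → Finₚ.<-trans e<d d<x) D<d)
... | tri< x<d _ _  with split x D-decr
...   | member x∈D        = member (there x∈D)
...   | exceeds D<x       = bumps [] D x<d D<x
...   | bumps U L x<y L<x = bumps (d ∷ U) L x<y L<x

module _ {n} {x : Letter n} {Y : Column n} where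
  open IsSegment

  IsSegment-insert-larger : ∀ {D} → IsSegment D Y → All (Fin._< x) D → IsSegment D (insert x Y)
  IsSegment-insert-larger D-seg D<x = record
    { decreasing = decreasing D-seg
    ; ⊆column    = All.zipWith (λ (d∈Y , d<x) → ∈insert-below d∈Y d<x) (⊆column D-seg , D<x)
    ; downClosed = λ z∈ d∈D z≤d →
        downClosed D-seg (∈insert⁻ z∈ (Finₚ.<⇒≢ (ℕₚ.≤-<-trans z≤d (All.lookup D<x d∈D)))) d∈D z≤d
    }

  IsSegment-insert-∷ : ∀ {D} → IsSegment D Y → All (Fin._< x) D →
                       ¬ (∃ λ t → t ∈ Y × All (Fin._< t) D × t Fin.< x) → IsSegment (x ∷ D) (insert x Y)
  IsSegment-insert-∷ {D} D-seg D<x no-gap = record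
    { decreasing = D<x ∷ decreasing D-seg
    ; ⊆column    = ∈insert x Y ∷ ⊆column (IsSegment-insert-larger D-seg D<x)
    ; downClosed = closed
    }
    where
    closed : ∀ {z d} → z ∈ insert x Y → d ∈ₗ x ∷ D → z Fin.≤ d → z ∈ₗ x ∷ D
    closed {z} z∈ d∈ z≤d with z Finₚ.≟ x
    ... | yes refl = here refl
    ... | no z≢x with d∈
    ...   | there d∈D = there (downClosed D-seg (∈insert⁻ z∈ z≢x) d∈D z≤d)
    ...   | here refl with All.all? (Finₚ._<? z) D
    ...     | yes D<z = ⊥-elim (no-gap (z , ∈insert⁻ z∈ z≢x , D<z , Finₚ.≤∧≢⇒< z≤d z≢x))
    ...     | no ¬D<z with find (Allₚ.¬All⇒Any¬ (Finₚ._<? z) D ¬D<z)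
    ...       | d′ , d′∈D , d′≮z = there (downClosed D-seg (∈insert⁻ z∈ z≢x) d′∈D (ℕₚ.≮⇒≥ d′≮z))

  IsSegment-insert-bump : ∀ U {y} L → IsSegment (U ++ y ∷ L) Y → x Fin.< y → All (Fin._< x) L →
                          IsSegment (U ++ x ∷ L) (insert x Y)
  IsSegment-insert-bump U {y} L D-seg x<y L<x = record
    { decreasing = decreasing-replace U (decreasing D-seg) x<y L<x
    ; ⊆column    = Allₚ.++⁺ (All.zipWith (λ (u∈Y , y<u) → ∈insert-above u∈Y y∈Y (ℕₚ.<⇒≤ x<y) y<u) (U⊆Y , y<U))
                             (∈insert x Y ∷ All.zipWith (λ (l∈Y , l<x) → ∈insert-below l∈Y l<x) (L⊆Y , L<x))
    ; downClosed = closed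
    }
    where
    y<U : All (y Fin.<_) U
    y<U = decreasing-above U (decreasing D-seg)
    U⊆Y = Allₚ.++⁻ˡ U (⊆column D-seg)
    y∈Y = All.head (Allₚ.++⁻ʳ U (⊆column D-seg))
    L⊆Y = All.tail (Allₚ.++⁻ʳ U (⊆column D-seg))

    y-least-above-x : ∀ {s} → s ∈ Y → x Fin.≤ s → y Fin.≤ s
    y-least-above-x {s} s∈Y x≤s with y Finₚ.≤? s
    ... | yes y≤s = y≤s
    ... | no  y≰s with ∈-++⁻ U (downClosed D-seg s∈Y (∈-++⁺ʳ U (here refl)) (ℕₚ.<⇒≤ (ℕₚ.≰⇒> y≰s)))
    ...   | inj₁ s∈U         = ⊥-elim (ℕₚ.<-asym (ℕₚ.≰⇒> y≰s) (All.lookup y<U s∈U))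
    ...   | inj₂ (here refl) = ⊥-elim (y≰s ℕₚ.≤-refl)
    ...   | inj₂ (there s∈L) = ⊥-elim (ℕₚ.<⇒≱ (All.lookup L<x s∈L) x≤s)

    y∉ : y ∉ insert x Y
    y∉ = bumped∉insert y∈Y x<y y-least-above-x

    bound-before-bump : ∀ {z d} → d ∈ₗ U ++ x ∷ L → z Fin.≤ d → ∃ λ d′ → d′ ∈ₗ U ++ y ∷ L × z Fin.≤ d′
    bound-before-bump {d = d} d∈ z≤d with ∈-++⁻ U d∈
    ... | inj₁ d∈U         = d , ∈-++⁺ˡ d∈U , z≤d
    ... | inj₂ (here refl) = y , ∈-++⁺ʳ U (here refl) , ℕₚ.≤-trans z≤d (ℕₚ.<⇒≤ x<y)
    ... | inj₂ (there d∈L) = d , ∈-++⁺ʳ U (there d∈L) , z≤d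

    closed : ∀ {z d} → z ∈ insert x Y → d ∈ₗ U ++ x ∷ L → z Fin.≤ d → z ∈ₗ U ++ x ∷ L
    closed {z} z∈ d∈ z≤d with z Finₚ.≟ x | bound-before-bump d∈ z≤d
    ... | yes refl | _             = ∈-++⁺ʳ U (here refl)
    ... | no  z≢x  | d′ , d′∈ , z≤d′ with ∈-++⁻ U (downClosed D-seg (∈insert⁻ z∈ z≢x) d′∈ z≤d′)
    ...   | inj₁ z∈U         = ∈-++⁺ˡ z∈U
    ...   | inj₂ (here refl) = ⊥-elim (y∉ z∈)
    ...   | inj₂ (there z∈L) = ∈-++⁺ʳ U (there z∈L)

-- Normal forms

infixr 5 _·0·_
_·0·_ : ∀ {n} → Word n → Word n → Word (suc n)
D ·0· E = shift D ++ zero ∷ shift E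

·0·-∷ʳ : ∀ {n} (D E : Word n) → D ·0· E ≡ (shift D ∷ʳ zero) ++ shift E
·0·-∷ʳ D E = sym (++-assoc (shift D) (zero ∷ []) (shift E))

·0·-++ : ∀ {n} (U V E : Word n) → (U ++ V) ·0· E ≡ shift U ++ V ·0· E
·0·-++ U V E = trans (cong (_++ zero ∷ shift E) (map-++ suc U V)) (++-assoc (shift U) (shift V) (zero ∷ shift E))

·0·-congʳ : ∀ {n} (D : Word n) {E E′} → E ~ E′ → (D ·0· E) ~ (D ·0· E′)
·0·-congʳ D E~E′ = ~-++ˡ (shift D) (~-∷ zero (~-shift E~E′))

col-shift : ∀ {n} (E : Word n) → col (shift E) ≡ false ∷ col E
col-shift {n} E = run-shift E false ∅

col-·0· : ∀ {n} (D E : Word n) → col (D ·0· E) ≡ true ∷ run D (dropMin (col E))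
col-·0· D E = begin
  col (D ·0· E)                                 ≡⟨ run-++ (shift D) (zero ∷ shift E) ∅ ⟩
  run (shift D) (insert zero (col (shift E)))    ≡⟨ cong (run (shift D) ∘ insert zero) (col-shift E) ⟩
  run (shift D) (true ∷ dropMin (col E))         ≡⟨ run-shift D true (dropMin (col E)) ⟩
  true ∷ run D (dropMin (col E))                 ∎
  where open ≡-Reasoning

run-∷ʳzero-false : ∀ {n} (D : Word n) γ → run (shift D ∷ʳ zero) (false ∷ γ) ≡ true ∷ run D (dropMin γ)
run-∷ʳzero-false D γ = trans (run-++ (shift D) (zero ∷ []) (false ∷ γ)) (run-shift D true (dropMin γ))

∈run-decreasing : ∀ {n} {x : Letter n} {D} γ → x ∈ₗ D → Decreasing D → x ∈ run D γ
∈run-decreasing {D = d ∷ D} γ (here refl) _             = ∈insert d (run D γ)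
∈run-decreasing {D = d ∷ D} γ (there x∈D) (D<d ∷ D-decr) =
  ∈insert-below (∈run-decreasing γ x∈D D-decr) (All.lookup D<d x∈D)

∈run-dropMin : ∀ {n} {Y : Column n} {D w z} → Decreasing D → All (_∈ Y) D → All (Fin._< w) D →
               w ∈ Y → z ∈ Y → w Fin.< z → z ∈ run D (dropMin Y)
∈run-dropMin {D = []}    _              _            _          w∈Y z∈Y w<z = ∈dropMin w∈Y w<z z∈Y
∈run-dropMin {D = d ∷ D} (D<d ∷ D-decr) (d∈Y ∷ D⊆Y) (d<w ∷ D<w) w∈Y z∈Y w<z =
  ∈insert-above (∈run-dropMin D-decr D⊆Y D<d d∈Y z∈Y (Finₚ.<-trans d<w w<z))
                (∈run-dropMin D-decr D⊆Y D<d d∈Y w∈Y d<w)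
                (ℕₚ.<⇒≤ d<w) w<z

passable-∷ʳzero : ∀ {n} {x t : Letter n} {D} E → Decreasing D → All (_∈ col E) D → All (Fin._< t) D →
                  t ∈ col E → t Fin.< x → Passable (suc x) (shift D ∷ʳ zero) (shift E)
passable-∷ʳzero {t = t} {[]} E _ _ _ t∈col t<x =
  (suc t , subst (suc t ∈_) (sym (col-shift E)) (there t∈col) , s≤s z≤n , s≤s t<x) , tt
passable-∷ʳzero {t = t} {d ∷ D} E (D<d ∷ D-decr) (d∈col ∷ D⊆col) (d<t ∷ D<t) t∈col t<x =
  (suc t , subst (suc t ∈_) (sym col-eq) (there (∈run-dropMin D-decr D⊆col D<d d∈col t∈col d<t)) , s≤s d<t , s≤s t<x)
  , passable-∷ʳzero E D-decr D⊆col D<d d∈col (Finₚ.<-trans d<t t<x)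
  where
  col-eq : col ((shift D ∷ʳ zero) ++ shift E) ≡ true ∷ run D (dropMin (col E))
  col-eq = trans (cong col (sym (·0·-∷ʳ D E))) (col-·0· D E)

repeat-behind : ∀ {n} {x : Letter n} L E → Decreasing L → All (_∈ col E) L → All (Fin._< x) L →
                (suc x ∷ L ·0· E) ~ (suc x ∷ L ·0· (x ∷ E))
repeat-behind []      E _ _ _ = ~sym (absorb-across [] (shift E) (s≤s z≤n) tt)
repeat-behind {x = x} (l ∷ L) E (L<l ∷ L-decr) (l∈col ∷ L⊆col) (l<x ∷ L<x) = begin
  suc x ∷ suc l ∷ L ·0· E
    ≡⟨ cong (λ w → suc x ∷ suc l ∷ w) (·0·-∷ʳ L E) ⟩
  suc x ∷ suc l ∷ (shift L ∷ʳ zero) ++ shift E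
    ≈⟨ absorb-across (shift L ∷ʳ zero) (shift E) (s≤s l<x) (passable-∷ʳzero E L-decr L⊆col L<l l∈col l<x) ⟨
  suc x ∷ suc l ∷ (shift L ∷ʳ zero) ++ suc x ∷ shift E
    ≡⟨ cong (λ w → suc x ∷ suc l ∷ w) (·0·-∷ʳ L (x ∷ E)) ⟨
  suc x ∷ suc l ∷ L ·0· (x ∷ E) ∎
  where open ~-Reasoning

fibre : ∀ {n} → Word n → List (Word (suc n))
fibre E = shift E ∷ List.map (_·0· E) (segments (col E))

normalForms : ∀ n → List (Word n)
normalForms zero    = [] ∷ []
normalForms (suc n) = List.concatMap fibre (normalForms n)

Normalisable : ∀ {n} → Word n → Set
Normalisable {n} w = ∃ λ e → e ∈ₗ normalForms n × w ~ e

shift∈normalForms : ∀ {n} {E : Word n} → E ∈ₗ normalForms n → shift E ∈ₗ normalForms (suc n)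
shift∈normalForms E∈ = ∈-concatMap⁺ fibre (lose E∈ (here refl))

·0·∈normalForms : ∀ {n} {E D : Word n} → E ∈ₗ normalForms n → D ∈ₗ segments (col E) →
                  (D ·0· E) ∈ₗ normalForms (suc n)
·0·∈normalForms {E = E} E∈ D∈ = ∈-concatMap⁺ fibre (lose E∈ (there (∈-map⁺ (_·0· E) D∈)))

[]∈normalForms : ∀ n → [] ∈ₗ normalForms n
[]∈normalForms zero    = here refl
[]∈normalForms (suc n) = shift∈normalForms ([]∈normalForms n)

data FibreView {n} : Word (suc n) → Set where
  shifted  : ∀ {E} → E ∈ₗ normalForms n → FibreView (shift E)
  through0 : ∀ {E D} → E ∈ₗ normalForms n → D ∈ₗ segments (col E) → FibreView (D ·0· E)

fibreView : ∀ {n} {e : Word (suc n)} → e ∈ₗ normalForms (suc n) → FibreView e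
fibreView {n} e∈ with find (∈-concatMap⁻ fibre {xs = normalForms n} e∈)
... | E , E∈ , here refl = shifted E∈
... | E , E∈ , there e∈ with ∈-map⁻ (_·0· E) e∈
...   | D , D∈ , refl = through0 E∈ D∈

module ColumnStep {n} {x : Letter n} {E E′ : Word n}
                  (E∈ : E ∈ₗ normalForms n) (E′∈ : E′ ∈ₗ normalForms n) (xE~E′ : (x ∷ E) ~ E′) where
  open IsSegment

  col-E′ : col E′ ≡ insert x (col E)
  col-E′ = sym (~⇒≐ xE~E′ ∅)

  ·0·E′∈normalForms : ∀ {D′} → IsSegment D′ (insert x (col E)) → (D′ ·0· E′) ∈ₗ normalForms (suc n)
  ·0·E′∈normalForms {D′} D′-seg =
    ·0·∈normalForms E′∈ (IsSegment⇒∈segments (col E′) (subst (IsSegment D′) (sym col-E′) D′-seg))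

  absorbed : ∀ {D} → IsSegment D (col E) → x ∈ₗ D → (suc x ∷ D ·0· E) ~ (D ·0· E)
  absorbed {D} D-seg x∈D = absorb (D ·0· E)
    (subst (suc x ∈_) (sym (col-·0· D E)) (there (∈run-decreasing (dropMin (col E)) x∈D (decreasing D-seg))))

  passes : ∀ {D t} → IsSegment D (col E) → t ∈ col E → All (Fin._< t) D → t Fin.< x →
           (suc x ∷ D ·0· E) ~ (D ·0· E′)
  passes {D} D-seg t∈col D<t t<x = begin
    suc x ∷ D ·0· E                  ≡⟨ cong (suc x ∷_) (·0·-∷ʳ D E) ⟩
    suc x ∷ (shift D ∷ʳ zero) ++ shift E
      ≈⟨ pass (shift D ∷ʳ zero) (shift E) (passable-∷ʳzero E (decreasing D-seg) (⊆column D-seg) D<t t∈col t<x) ⟩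
    (shift D ∷ʳ zero) ++ suc x ∷ shift E  ≡⟨ ·0·-∷ʳ D (x ∷ E) ⟨
    D ·0· (x ∷ E)                    ≈⟨ ·0·-congʳ D xE~E′ ⟩
    D ·0· E′                         ∎
    where open ~-Reasoning

  enters : ∀ {D} → Decreasing D → All (_∈ col E) D → All (Fin._< x) D → (suc x ∷ D ·0· E) ~ ((x ∷ D) ·0· E′)
  enters {D} D-decr D⊆col D<x = ~trans (repeat-behind D E D-decr D⊆col D<x) (~-∷ (suc x) (·0·-congʳ D xE~E′))

  bumps-into : ∀ U {y} L → IsSegment (U ++ y ∷ L) (col E) → x Fin.< y → All (Fin._< x) L →
               (suc x ∷ (U ++ y ∷ L) ·0· E) ~ ((U ++ x ∷ L) ·0· E′)
  bumps-into U {y} L D-seg x<y L<x = begin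
    suc x ∷ (U ++ y ∷ L) ·0· E          ≡⟨ cong (suc x ∷_) (·0·-++ U (y ∷ L) E) ⟩
    suc x ∷ shift U ++ suc y ∷ L ·0· E  ≈⟨ pass-above (shift U) (L ·0· E) (s≤s x<y) (decreasing-shift U-decr) (gmap⁺ s≤s y<U) ⟩
    shift U ++ suc x ∷ suc y ∷ L ·0· E  ≈⟨ ~-++ˡ (shift U) y-dropped ⟩
    shift U ++ suc x ∷ L ·0· E          ≈⟨ ~-++ˡ (shift U) (enters L-decr L⊆col L<x) ⟩
    shift U ++ (x ∷ L) ·0· E′           ≡⟨ ·0·-++ U (x ∷ L) E′ ⟨
    (U ++ x ∷ L) ·0· E′                 ∎
    where
    open ~-Reasoning
    D-decr = decreasing D-seg
    U-decr = AllPairs-++⁻ˡ U D-decr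
    y<U = decreasing-above U D-decr
    L-decr : Decreasing L
    L-decr = AllPairs.tail (AllPairs-++⁻ʳ U D-decr)
    y∈col : y ∈ col E
    y∈col = All.head (Allₚ.++⁻ʳ U (⊆column D-seg))
    L⊆col : All (_∈ col E) L
    L⊆col = All.tail (Allₚ.++⁻ʳ U (⊆column D-seg))
    y-dropped : (suc x ∷ suc y ∷ L ·0· E) ~ (suc x ∷ L ·0· E)
    y-dropped = begin
      suc x ∷ suc y ∷ L ·0· E                    ≡⟨ cong (λ w → suc x ∷ suc y ∷ w) (·0·-∷ʳ L E) ⟩
      suc x ∷ suc y ∷ (shift L ∷ʳ zero) ++ shift E
        ≈⟨ hop-below (shift L ∷ʳ zero) (shift E) L0<x (s≤s x<y) (decreasing-∷ʳzero L-decr) ⟩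
      suc x ∷ (shift L ∷ʳ zero) ++ suc y ∷ shift E ≡⟨ cong (suc x ∷_) (·0·-∷ʳ L (y ∷ E)) ⟨
      suc x ∷ L ·0· (y ∷ E)                      ≈⟨ ~-∷ (suc x) (·0·-congʳ L (absorb E y∈col)) ⟩
      suc x ∷ L ·0· E                            ∎
      where
      L0<x : All (Fin._< suc x) (shift L ∷ʳ zero)
      L0<x = Allₚ.++⁺ (gmap⁺ s≤s L<x) (s≤s z≤n ∷ [])

  gap? : ∀ (D : Word n) → Dec (∃ λ t → t ∈ col E × All (Fin._< t) D × t Fin.< x)
  gap? D = Finₚ.any? {n = n} (λ t → (t ∈? col E) ×-dec All.all? (Finₚ._<? t) D ×-dec (t Finₚ.<? x))

  -- Column insertion of x into D 0 E: x is absorbed if it is a letter of D; if it exceeds D,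
  -- it passes on to E when some t in the column of E lies between, and joins D otherwise;
  -- else it replaces the least letter y of D above it, and y, pushed behind 0, is absorbed by E.
  normalise : ∀ {D} → D ∈ₗ segments (col E) → Normalisable (suc x ∷ D ·0· E)
  normalise {D} D∈ with D-seg ← ∈segments⇒IsSegment (col E) D∈ | split x (decreasing D-seg)
  ... | member x∈D = D ·0· E , ·0·∈normalForms E∈ D∈ , absorbed D-seg x∈D
  ... | bumps U L x<y L<x =
    (U ++ x ∷ L) ·0· E′ , ·0·E′∈normalForms (IsSegment-insert-bump U L D-seg x<y L<x) , bumps-into U L D-seg x<y L<x
  ... | exceeds D<x with gap? D
  ...   | yes (t , t∈col , D<t , t<x) =
    D ·0· E′ , ·0·E′∈normalForms (IsSegment-insert-larger D-seg D<x) , passes D-seg t∈col D<t t<x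
  ...   | no no-gap =
    (x ∷ D) ·0· E′ , ·0·E′∈normalForms (IsSegment-insert-∷ D-seg D<x no-gap) ,
    enters (decreasing D-seg) (⊆column D-seg) D<x

normalise-∷ : ∀ {n} (x : Letter n) {e} → e ∈ₗ normalForms n → Normalisable (x ∷ e)
normalise-∷ {suc n} x e∈ with fibreView e∈
normalise-∷ zero    _  | shifted {E} E∈ =
  [] ·0· E , ·0·∈normalForms E∈ (IsSegment⇒∈segments (col E) ([]-IsSegment (col E))) , ~refl
normalise-∷ zero    e∈ | through0 {E} {D} _ _ =
  D ·0· E , e∈ , absorb-after-larger (shift D) (shift E) (zero<shift D)
normalise-∷ (suc x) _  | shifted E∈ with normalise-∷ x E∈
... | E′ , E′∈ , xE~E′ = shift E′ , shift∈normalForms E′∈ , ~-shift xE~E′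
normalise-∷ (suc x) _  | through0 E∈ D∈ with normalise-∷ x E∈
... | E′ , E′∈ , xE~E′ = ColumnStep.normalise E∈ E′∈ xE~E′ D∈

normalise : ∀ {n} (w : Word n) → Normalisable w
normalise []      = [] , []∈normalForms _ , ~refl
normalise (x ∷ w) with normalise w
... | e , e∈ , w~e with normalise-∷ x e∈
...   | e′ , e′∈ , xe~e′ = e′ , e′∈ , ~trans (~-∷ x w~e) xe~e′

-- Distinct normal forms act differently

run-fibre : ∀ {n} {E : Word n} {a} → a ∈ₗ fibre E → ∀ γ → run a (true ∷ γ) ≡ true ∷ run E γ
run-fibre {E = E} (here refl) γ = run-shift E true γ
run-fibre {E = E} (there a∈) γ with ∈-map⁻ (_·0· E) a∈
... | D , D∈ , refl = begin
  run (D ·0· E) (true ∷ γ)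
    ≡⟨ run-++ (shift D) (zero ∷ shift E) (true ∷ γ) ⟩
  run (shift D) (insert zero (run (shift E) (true ∷ γ)))
    ≡⟨ cong (run (shift D) ∘ insert zero) (run-shift E true γ) ⟩
  run (shift D) (true ∷ run E γ)
    ≡⟨ run-shift D true (run E γ) ⟩
  true ∷ run D (run E γ)
    ≡⟨ cong (true ∷_) (run-++ D E γ) ⟨
  true ∷ run (D ++ E) γ
    ≡⟨ cong (true ∷_) (~⇒≐ (absorb-all D E (IsSegment.⊆column (∈segments⇒IsSegment (col E) D∈))) γ) ⟩
  true ∷ run E γ ∎
  where open ≡-Reasoning

false∷≢true∷ : ∀ {n} {γ δ : Column n} → false ∷ γ ≢ true ∷ δ
false∷≢true∷ ()

segments-distinct : ∀ {n} (Y : Column n) → AllPairs (λ D D′ → run D (dropMin Y) ≢ run D′ (dropMin Y)) (segments Y)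
segments-distinct []          = [] ∷ []
segments-distinct (true ∷ Y)  =
  Allₚ.map⁺ (All.universal (λ D eq → false∷≢true∷ (trans eq (run-∷ʳzero-false D Y))) (segments Y))
  ∷ AllPairsₚ.map⁺ (AllPairs.map (λ {D} {D′} ne eq → ne (Vecₚ.∷-injectiveʳ
      (trans (sym (run-∷ʳzero-false D Y)) (trans eq (run-∷ʳzero-false D′ Y))))) (segments-distinct Y))
segments-distinct (false ∷ Y) =
  AllPairsₚ.map⁺ (AllPairs.map (λ {D} {D′} ne eq → ne (Vecₚ.∷-injectiveʳ
      (trans (sym (run-shift D false (dropMin Y))) (trans eq (run-shift D′ false (dropMin Y)))))) (segments-distinct Y))

_≉_ : ∀ {n} → Word n → Word n → Set
u ≉ v = ¬ (u ≐ v)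

fibre-distinct : ∀ {n} (E : Word n) → AllPairs _≉_ (fibre E)
fibre-distinct E =
  Allₚ.map⁺ (All.universal (λ D eq → false∷≢true∷ (trans (sym (col-shift E)) (trans (eq ∅) (col-·0· D E))))
                           (segments (col E)))
  ∷ AllPairsₚ.map⁺ (AllPairs.map (λ {D} {D′} ne eq → ne (Vecₚ.∷-injectiveʳ
      (trans (sym (col-·0· D E)) (trans (eq ∅) (col-·0· D′ E))))) (segments-distinct (col E)))

normalForms-distinct : ∀ n → AllPairs _≉_ (normalForms n)
normalForms-distinct zero    = [] ∷ []
normalForms-distinct (suc n) =
  AllPairsₚ.concat⁺ (Allₚ.map⁺ (All.universal fibre-distinct (normalForms n)))
                    (AllPairsₚ.map⁺ (AllPairs.map across (normalForms-distinct n)))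
  where
  across : ∀ {E E′} → E ≉ E′ → All (λ a → All (a ≉_) (fibre E′)) (fibre E)
  across E≉E′ = All.tabulate λ a∈ → All.tabulate λ b∈ a≐b →
    E≉E′ λ γ → Vecₚ.∷-injectiveʳ (trans (sym (run-fibre a∈ γ)) (trans (a≐b (true ∷ γ)) (run-fibre b∈ γ)))

normalForm-unique : ∀ {n} {e e′ : Word n} → e ∈ₗ normalForms n → e′ ∈ₗ normalForms n → e ≐ e′ → e ≡ e′
normalForm-unique {n} = ∈-injective (λ e≐e′ γ → sym (e≐e′ γ)) (normalForms-distinct n)

≐⇒~ : ∀ {n} (u v : Word n) → u ≐ v → u ~ v
≐⇒~ u v u≐v with normalise u | normalise v
... | e , e∈ , u~e | e′ , e′∈ , v~e′ =
  ~trans u~e (~trans (≡⇒~ (normalForm-unique e∈ e′∈ e≐e′)) (~sym v~e′))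
  where
  e≐e′ : e ≐ e′
  e≐e′ γ = trans (sym (~⇒≐ u~e γ)) (trans (u≐v γ) (~⇒≐ v~e′ γ))

-- Counting normal forms

segments-sum : ∀ {n} (Y : Column n) (h : ℕ → ℕ) →
               ∑ (λ D → h (suc ∣ run D (dropMin Y) ∣)) (segments Y) ≡ ∣ Y ∣ * h ∣ Y ∣ + h (suc ∣ Y ∣)
segments-sum []          h = ℕₚ.+-identityʳ (h 1)
segments-sum (true  ∷ Y) h = begin
  h (suc ∣ Y ∣) + ∑ (λ D → h (suc ∣ run D (false ∷ Y) ∣)) (List.map (λ D → shift D ∷ʳ zero) (segments Y))
    ≡⟨ cong (h (suc ∣ Y ∣) +_) (∑-map _ (λ D → shift D ∷ʳ zero) (segments Y)) ⟩
  h (suc ∣ Y ∣) + ∑ (λ D → h (suc ∣ run (shift D ∷ʳ zero) (false ∷ Y) ∣)) (segments Y)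
    ≡⟨ cong (h (suc ∣ Y ∣) +_) (∑-cong (λ D → cong (λ γ → h (suc ∣ γ ∣)) (run-∷ʳzero-false D Y)) (segments Y)) ⟩
  h (suc ∣ Y ∣) + ∑ (λ D → h (suc (suc ∣ run D (dropMin Y) ∣))) (segments Y)
    ≡⟨ cong (h (suc ∣ Y ∣) +_) (segments-sum Y (h ∘ suc)) ⟩
  h (suc ∣ Y ∣) + (∣ Y ∣ * h (suc ∣ Y ∣) + h (suc (suc ∣ Y ∣)))
    ≡⟨ ℕₚ.+-assoc (h (suc ∣ Y ∣)) _ _ ⟨
  suc ∣ Y ∣ * h (suc ∣ Y ∣) + h (suc (suc ∣ Y ∣)) ∎
  where open ≡-Reasoning
segments-sum (false ∷ Y) h = begin
  ∑ (λ D → h (suc ∣ run D (false ∷ dropMin Y) ∣)) (List.map shift (segments Y))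
    ≡⟨ ∑-map _ shift (segments Y) ⟩
  ∑ (λ D → h (suc ∣ run (shift D) (false ∷ dropMin Y) ∣)) (segments Y)
    ≡⟨ ∑-cong (λ D → cong (λ γ → h (suc ∣ γ ∣)) (run-shift D false (dropMin Y))) (segments Y) ⟩
  ∑ (λ D → h (suc ∣ run D (dropMin Y) ∣)) (segments Y)
    ≡⟨ segments-sum Y h ⟩
  ∣ Y ∣ * h ∣ Y ∣ + h (suc ∣ Y ∣) ∎
  where open ≡-Reasoning

fibre-sum : ∀ {n} (E : Word n) (g : ℕ → ℕ) →
            ∑ (λ a → g ∣ col a ∣) (fibre E) ≡ suc ∣ col E ∣ * g ∣ col E ∣ + g (suc ∣ col E ∣)
fibre-sum E g = begin
  g ∣ col (shift E) ∣ + ∑ (λ a → g ∣ col a ∣) (List.map (_·0· E) (segments (col E)))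
    ≡⟨ cong₂ _+_ (cong (λ γ → g ∣ γ ∣) (col-shift E)) (∑-map _ (_·0· E) (segments (col E))) ⟩
  g ∣ col E ∣ + ∑ (λ D → g ∣ col (D ·0· E) ∣) (segments (col E))
    ≡⟨ cong (g ∣ col E ∣ +_) (∑-cong (λ D → cong (λ γ → g ∣ γ ∣) (col-·0· D E)) (segments (col E))) ⟩
  g ∣ col E ∣ + ∑ (λ D → g (suc ∣ run D (dropMin (col E)) ∣)) (segments (col E))
    ≡⟨ cong (g ∣ col E ∣ +_) (segments-sum (col E) g) ⟩
  g ∣ col E ∣ + (∣ col E ∣ * g ∣ col E ∣ + g (suc ∣ col E ∣))
    ≡⟨ ℕₚ.+-assoc (g ∣ col E ∣) _ _ ⟨
  suc ∣ col E ∣ * g ∣ col E ∣ + g (suc ∣ col E ∣) ∎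
  where open ≡-Reasoning

normalForms-sum : ∀ n (g : ℕ → ℕ) →
                  ∑ (λ a → g ∣ col a ∣) (normalForms n) ≡ sumTo (λ k → stirling2 (suc n) (suc k) * g k) n
normalForms-sum zero    g = refl
normalForms-sum (suc n) g = begin
  ∑ (λ a → g ∣ col a ∣) (List.concatMap fibre (normalForms n))     ≡⟨ ∑-concatMap _ fibre (normalForms n) ⟩
  ∑ (λ E → ∑ (λ a → g ∣ col a ∣) (fibre E)) (normalForms n)       ≡⟨ ∑-cong (λ E → fibre-sum E g) (normalForms n) ⟩
  ∑ (λ E → suc ∣ col E ∣ * g ∣ col E ∣ + g (suc ∣ col E ∣)) (normalForms n)
    ≡⟨ normalForms-sum n (λ k → suc k * g k + g (suc k)) ⟩
  sumTo (λ k → stirling2 (suc n) (suc k) * (suc k * g k + g (suc k))) n ≡⟨ stirling2-sum-step n g ⟩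
  sumTo (λ k → stirling2 (suc (suc n)) (suc k) * g k) (suc n) ∎
  where open ≡-Reasoning

length-normalForms : ∀ n → List.length (normalForms n) ≡ bell (suc n)
length-normalForms n = begin
  List.length (normalForms n)                   ≡⟨ length≡∑1 (normalForms n) ⟩
  ∑ (λ _ → 1) (normalForms n)                   ≡⟨ normalForms-sum n (λ _ → 1) ⟩
  sumTo (λ k → stirling2 (suc n) (suc k) * 1) n ≡⟨ sumTo-cong (λ k → ℕₚ.*-identityʳ _) n ⟩
  sumTo (stirling2 (suc n) ∘ suc) n             ≡⟨ sumTo-head (stirling2 (suc n)) n ⟨
  bell (suc n)                                  ∎
  where open ≡-Reasoning

theorem8p1 : (n : ℕ) →
    (Σ (Vec (Word n) (bell (suc n))) λ ws →
        (∀ i j → lookup ws i ≡styl lookup ws j → i ≡ j)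
      × (∀ (w : Word n) → ∃ λ i → w ≡styl lookup ws i))
    × (∀ (u v : Word n) → (u ≡styl v) ⇔ (u ~ v))
theorem8p1 n with enumerate (λ {u} {v} u≡v γ → sym (u≡v γ)) (normalForms n) NF-distinct (length-normalForms n)
  where
  NF-distinct : AllPairs (λ u v → ¬ u ≡styl v) (normalForms n)
  NF-distinct = AllPairs.map (λ {u} {v} u≉v u≡v → u≉v (≡styl⇒≐ u v u≡v)) (normalForms-distinct n)
... | ws , injective , enumerates =
  (ws , injective , represented) , λ u v → mk⇔ (≐⇒~ u v ∘ ≡styl⇒≐ u v) (≐⇒≡styl u v ∘ ~⇒≐)
  where
  represented : ∀ w → ∃ λ i → w ≡styl lookup ws i
  represented w with normalise w
  ... | e , e∈ , w~e with enumerates e∈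
  ...   | i , refl = i , ≐⇒≡styl w (lookup ws i) (~⇒≐ w~e)
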